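{- For any positive integers $m,n$, there are $2^{\aleph_0}$ $(2mn,n)$-filling families of subsets of $\mathbb{Z}^{2mn}$.
   Context: $[k]=\{1,\dots,k\}$. $\mathbb{Z}^d$ is the graph with edges $\{x,x+e_i\}$; $\Gamma(x)=\{x\pm e_i:i\in[d]\}$. For $M$ a multiple of $n$, a family $\{X^i_j\}_{i\in[\frac{M+n}{n}],j\in[2n]}$ of subsets of $\mathbb{Z}^M$, with $X^i=\bigsqcup_j X^i_j$, is $(M,n)$-filling if it partitions $\mathbb{Z}^M$ and for each $i,j$: if $x\in\mathbb{Z}^M\setminus X^i$ then $|\Gamma(x)\cap X^i_j|=1$, and if $x\in X^i$ then $\Gamma(x)\cap X^i=\emptyset$. -}

module Defs where

open import Data.Nat using (ℕ; _+_; _*_; _/_; NonZero)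
open import Data.Integer using (ℤ; suc; pred)
open import Data.Fin using (Fin)
open import Data.Vec using (Vec; updateAt)
open import Data.Bool using (Bool)
open import Data.Product using (Σ; _×_; ∃; proj₁; _,_)
open import Data.Sum using (_⊎_)
open import Relation.Binary.PropositionalEquality using (_≡_; _≢_)

Pt : ℕ → Set
Pt M = Vec ℤ M

Γ : {M : ℕ} → Pt M → Pt M → Set
Γ {M} x y = Σ (Fin M) λ i → (y ≡ updateAt x i suc) ⊎ (y ≡ updateAt x i pred)

-- A family {X^i_j}, i ∈ [(M+n)/n], j ∈ [2n], partitioning ℤ^M, given by its
-- labelling function: x ∈ X^i_j  iff  label x ≡ (i , j).
Family : (M n : ℕ) → .{{NonZero n}} → Set
Family M n = Pt M → Fin ((M + n) / n) × Fin (2 * n)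

IsFilling : (M n : ℕ) → .{{_ : NonZero n}} → Family M n → Set
IsFilling M n X =
  ∀ (i : Fin ((M + n) / n)) (j : Fin (2 * n)) (x : Pt M) →
    (proj₁ (X x) ≢ i →
       Σ (Pt M) λ y → (Γ x y × X y ≡ (i , j)) ×
         (∀ z → Γ x z → X z ≡ (i , j) → z ≡ y))
  ×
    (proj₁ (X x) ≡ i → ∀ y → Γ x y → proj₁ (X y) ≢ i)

-- There are exactly 2^ℵ₀ (M,n)-filling families: an injection of Cantor
-- space into the filling families and an injection of the filling families
-- into Cantor space (equality of families = pointwise equality of labels).
ContinuumManyFilling : (M n : ℕ) → .{{_ : NonZero n}} → Set
ContinuumManyFilling M n =
  (Σ ((ℕ → Bool) → Family M n) λ F →
     (∀ α → IsFilling M n (F α)) ×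
     (∀ α β → (∀ x → F α x ≡ F β x) → ∀ k → α k ≡ β k))
  ×
  (Σ (Family M n → (ℕ → Bool)) λ G →
     ∀ X Y → IsFilling M n X → IsFilling M n Y →
       (∀ k → G X k ≡ G Y k) → ∀ x → X x ≡ Y x)

module Submission where

-- Index the M axes by pairs (a, b) with a ∈ [1, m] (the weight) and b ∈ [0, 2n)
-- (the phase), and let N = 2m + 1 = (M + n)/n.  For x ∈ ℤ^M put
--   R x = Σ weight_k x_k,  W x = Σ phase_k x_k,  T x = Σ x_k,
-- and, for a bit sequence α, label x by ( R x mod N , W x + α(T x) mod 2n ),
-- reading α(t) as 0 for t < 0.  Modulo 2m + 1 every non-zero class is ±a for a
-- unique sign and a unique a ∈ [1, m] (module Balanced).  Hence a point outside
-- X^i has neighbours in X^i only in one direction and with one weight; among the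
-- 2n axes of that weight the phase picks exactly one neighbour in each X^i_j,
-- since T changes by the same ±1 along all of them.  A point of X^i has no
-- neighbour in X^i, as a step changes R by ±a ≢ 0.  The label at the point
-- (t, 0, …, 0) reveals α(t), so distinct α give distinct families; conversely any
-- family is coded by a bit sequence through an enumeration of ℤ^M × ℕ.

open import Defs
open import Data.Bool using (Bool; true; false)
open import Data.Empty using (⊥-elim)
open import Data.Fin as Fin using (Fin; toℕ; fromℕ<; combine; remQuot)
open import Data.Fin.Properties using (toℕ-fromℕ<; toℕ-injective; toℕ<n; *↔×; remQuot-combine)
open import Data.Integer as ℤ using (ℤ; +_; -[1+_]; _⊖_; 0ℤ; 1ℤ; -1ℤ; _+_; _-_; -_; ∣_∣; _%ℕ_; _/ℕ_)
import Data.Integer.Properties as ℤ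
open import Data.Integer.DivMod using (n%ℕd<d; a≡a%ℕn+[a/ℕn]*n)
open import Data.Integer.Divisibility.Signed using (_∣_; divides; ∣⇒∣ᵤ; ∣m⇒∣-m; ∣m∣n⇒∣m+n; ∣n⇒∣m*n)
open import Data.Integer.Tactic.RingSolver using (solve-∀)
open import Data.Nat as ℕ using (ℕ; _*_; NonZero; zero; suc; _<_; _≤_; _∸_; _≤?_; z≤n; s≤s; _/_)
import Data.Nat.Properties as ℕ
open import Data.Nat.DivMod using (m<n⇒m%n≡m; /-congˡ; m*n/n≡m)
import Data.Nat.Divisibility as ℕ
import Data.Nat.Tactic.RingSolver as ℕ-Solver
open import Data.Product using (Σ; _×_; _,_; proj₁; proj₂)
open import Data.Sum using (inj₁; inj₂)
open import Data.Vec using (Vec; []; _∷_; updateAt; replicate)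
open import Function using (_∘_; Inverse; _↔_)
open import Level using (0ℓ)
open import Relation.Binary.Bundles using (Setoid)
open import Relation.Binary.Structures using (IsEquivalence)
open import Relation.Binary.PropositionalEquality
import Relation.Binary.Reasoning.Setoid as SetoidReasoning
open import Relation.Nullary using (¬_; Dec; yes; no; does)
open import Relation.Nullary.Decidable using (dec-true)

data Dir : Set where
  up down : Dir

sgn : Dir → ℤ
sgn up   = 1ℤ
sgn down = -1ℤ

sgn-involutive : ∀ d a → sgn d ℤ.* (sgn d ℤ.* a) ≡ a
sgn-involutive d a = begin
  sgn d ℤ.* (sgn d ℤ.* a)  ≡⟨ ℤ.*-assoc (sgn d) (sgn d) a ⟨
  sgn d ℤ.* sgn d ℤ.* a    ≡⟨ cong (λ s → s ℤ.* a) (sgn² d) ⟩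
  1ℤ ℤ.* a                 ≡⟨ ℤ.*-identityˡ a ⟩
  a                        ∎
  where
  open ≡-Reasoning
  sgn² : ∀ d → sgn d ℤ.* sgn d ≡ 1ℤ
  sgn² up   = refl
  sgn² down = refl

module Residues (P : ℕ) .{{_ : NonZero P}} where

  -- a ≈ b iff P divides a - b (a record, so that a and b are inferable).
  infix 4 _≈_
  record _≈_ (a b : ℤ) : Set where
    constructor ≈-intro
    field divides-difference : + P ∣ a - b
  open _≈_

  -- Every congruence below is a divisibility fact about a ring expression of the
  -- differences involved; `by` transports it along the ring identity.
  private
    by : ∀ {x a b} → x ≡ a - b → + P ∣ x → a ≈ b
    by e p = ≈-intro (subst (+ P ∣_) e p)

  ≈-reflexive : ∀ {a b} → a ≡ b → a ≈ b
  ≈-reflexive {a} refl = ≈-intro (divides 0ℤ (ℤ.+-inverseʳ a))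

  ≈-refl : ∀ {a} → a ≈ a
  ≈-refl = ≈-reflexive refl

  ≈-sym : ∀ {a b} → a ≈ b → b ≈ a
  ≈-sym {a} {b} p = by (flip a b) (∣m⇒∣-m (divides-difference p))
    where
    flip : ∀ a b → - (a - b) ≡ b - a
    flip = solve-∀

  ≈-trans : ∀ {a b c} → a ≈ b → b ≈ c → a ≈ c
  ≈-trans {a} {b} {c} p q =
    by (chain a b c) (∣m∣n⇒∣m+n (divides-difference p) (divides-difference q))
    where
    chain : ∀ a b c → (a - b) + (b - c) ≡ a - c
    chain = solve-∀

  +-cong : ∀ {a b c d} → a ≈ b → c ≈ d → a + c ≈ b + d
  +-cong {a} {b} {c} {d} p q =
    by (regroup a b c d) (∣m∣n⇒∣m+n (divides-difference p) (divides-difference q))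
    where
    regroup : ∀ a b c d → (a - b) + (c - d) ≡ (a + c) - (b + d)
    regroup = solve-∀

  *-congˡ : ∀ k {a b} → a ≈ b → k ℤ.* a ≈ k ℤ.* b
  *-congˡ k {a} {b} p = by (distrib k a b) (∣n⇒∣m*n k (divides-difference p))
    where
    distrib : ∀ k a b → k ℤ.* (a - b) ≡ k ℤ.* a - k ℤ.* b
    distrib = solve-∀

  +-cancelˡ : ∀ c {a b} → c + a ≈ c + b → a ≈ b
  +-cancelˡ c {a} {b} p = by (cancel c a b) (divides-difference p)
    where
    cancel : ∀ c a b → (c + a) - (c + b) ≡ a - b
    cancel = solve-∀

  transpose : ∀ a {s t} → a + s ≈ t → s ≈ t - a
  transpose a {s} {t} p = by (same a s t) (divides-difference p)
    where
    same : ∀ a s t → (a + s) - t ≡ s - (t - a)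
    same = solve-∀

  transpose⁻ : ∀ a {s t} → s ≈ t - a → a + s ≈ t
  transpose⁻ a {s} {t} p = by (same a s t) (divides-difference p)
    where
    same : ∀ a s t → s - (t - a) ≡ (a + s) - t
    same = solve-∀

  ≈-isEquivalence : IsEquivalence _≈_
  ≈-isEquivalence = record { refl = ≈-refl ; sym = ≈-sym ; trans = ≈-trans }

  ≈-setoid : Setoid 0ℓ 0ℓ
  ≈-setoid = record { isEquivalence = ≈-isEquivalence }

  module ≈-Reasoning = SetoidReasoning ≈-setoid

  ≈-residue : ∀ a → a ≈ + (a %ℕ P)
  ≈-residue a = ≈-intro (divides (a /ℕ P) (begin
    a - r                     ≡⟨ cong (_- r) (a≡a%ℕn+[a/ℕn]*n a P) ⟩
    (r + a /ℕ P ℤ.* + P) - r  ≡⟨ cancel r (a /ℕ P ℤ.* + P) ⟩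
    a /ℕ P ℤ.* + P            ∎))
    where
    open ≡-Reasoning
    r : ℤ
    r = + (a %ℕ P)
    cancel : ∀ r s → (r + s) - r ≡ s
    cancel = solve-∀

  -- Distinct naturals below P are incongruent: their distance is below P.
  ≈-small : ∀ {u v} → u < P → v < P → + u ≈ + v → u ≡ v
  ≈-small {u} {v} u<P v<P p =
    cong ∣_∣ (ℤ.i-j≡0⇒i≡j (+ u) (+ v) (ℤ.∣i∣≡0⇒i≡0 dist≡0))
    where
    dist<P : ∣ + u - + v ∣ < P
    dist<P = subst (λ x → ∣ x ∣ < P) (sym (ℤ.m-n≡m⊖n u v))
               (ℕ.≤-<-trans (ℤ.∣m⊝n∣≤m⊔n u v) (ℕ.⊔-lub u<P v<P))
    dist≡0 : ∣ + u - + v ∣ ≡ 0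
    dist≡0 = trans (sym (m<n⇒m%n≡m dist<P))
                   (ℕ.n∣m⇒m%n≡0 _ P (∣⇒∣ᵤ (divides-difference p)))

  minus-modulus : ∀ a → a - + P ≈ a
  minus-modulus a = by (cancel a (+ P)) (divides -1ℤ refl)
    where
    cancel : ∀ a p → -1ℤ ℤ.* p ≡ (a - p) - a
    cancel = solve-∀

  cls : ℤ → Fin P
  cls a = fromℕ< (n%ℕd<d a P)

  cls≡⇒≈ : ∀ {a} {i : Fin P} → cls a ≡ i → a ≈ + toℕ i
  cls≡⇒≈ {a} {i} e = begin
    a              ≈⟨ ≈-residue a ⟩
    + (a %ℕ P)     ≡⟨ cong +_ (toℕ-fromℕ< (n%ℕd<d a P)) ⟨
    + toℕ (cls a)  ≡⟨ cong (λ j → + toℕ j) e ⟩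
    + toℕ i        ∎
    where open ≈-Reasoning

  cls-injective : ∀ {a b} → cls a ≡ cls b → a ≈ b
  cls-injective {a} {b} e = ≈-trans (cls≡⇒≈ e) (≈-sym (cls≡⇒≈ refl))

  ≈⇒cls≡ : ∀ {a} {i : Fin P} → a ≈ + toℕ i → cls a ≡ i
  ≈⇒cls≡ {a} {i} p = toℕ-injective (trans (toℕ-fromℕ< _)
    (≈-small (n%ℕd<d a P) (toℕ<n i) (≈-trans (≈-sym (≈-residue a)) p)))

  sgn-cancel : ∀ d {a b} → sgn d ℤ.* a ≈ sgn d ℤ.* b → a ≈ b
  sgn-cancel d {a} {b} p = begin
    a                        ≡⟨ sgn-involutive d a ⟨
    sgn d ℤ.* (sgn d ℤ.* a)  ≈⟨ *-congˡ (sgn d) p ⟩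
    sgn d ℤ.* (sgn d ℤ.* b)  ≡⟨ sgn-involutive d b ⟩
    b                        ∎
    where open ≈-Reasoning

  signed-residue : ∀ d r → Σ ℕ λ b → b < P × sgn d ℤ.* + b ≈ r
  signed-residue d r = b , n%ℕd<d (sgn d ℤ.* r) P , (begin
    sgn d ℤ.* + b            ≈⟨ *-congˡ (sgn d) (≈-sym (≈-residue (sgn d ℤ.* r))) ⟩
    sgn d ℤ.* (sgn d ℤ.* r)  ≡⟨ sgn-involutive d r ⟩
    r                        ∎)
    where
    open ≈-Reasoning
    b : ℕ
    b = (sgn d ℤ.* r) %ℕ P

  signed-small : ∀ d {u v} → u < P → v < P → sgn d ℤ.* + u ≈ sgn d ℤ.* + v → u ≡ v
  signed-small d u<P v<P p = ≈-small u<P v<P (sgn-cancel d p)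

-- Modulo P = 2m + 1 every non-zero class is ±a for a unique sign and a unique
-- a ∈ [1, m]; this is what makes each class reachable by exactly one kind of step.
module Balanced (m P : ℕ) .{{_ : NonZero P}} (P≡2m+1 : P ≡ ℕ.suc (m ℕ.+ m)) where

  open Residues P

  InRange : ℕ → Set
  InRange a = 1 ≤ a × a ≤ m

  record BalancedRep (r : ℤ) : Set where
    field
      dir     : Dir
      size    : ℕ
      inRange : InRange size
      rep     : r ≈ sgn dir ℤ.* + size

  private
    m<P : m < P
    m<P = subst (m <_) (sym P≡2m+1) (s≤s (ℕ.m≤m+n m m))

    sum<P : ∀ {a a'} → a ≤ m → a' ≤ m → a ℕ.+ a' < P
    sum<P a≤m a'≤m = subst (_ <_) (sym P≡2m+1) (s≤s (ℕ.+-mono-≤ a≤m a'≤m))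

  -- Every non-zero class has one: its residue v if v ≤ m, otherwise -(P - v).
  balanced-rep : ∀ r → ¬ r ≈ 0ℤ → BalancedRep r
  balanced-rep r r≉0 = by-size (v ≤? m)
    where
    v : ℕ
    v = r %ℕ P

    v<P : v < P
    v<P = n%ℕd<d r P

    v≥1 : 1 ≤ v
    v≥1 = ℕ.n≢0⇒n>0 λ v≡0 → r≉0 (≈-trans (≈-residue r) (≈-reflexive (cong +_ v≡0)))

    -- if v > m then P - v ≤ m, since P = 2m + 1 ≤ v + m
    P∸v≤m : ¬ v ≤ m → P ∸ v ≤ m
    P∸v≤m v≰m = ℕ.m≤n+o⇒m∸n≤o P v
                  (subst (_≤ v ℕ.+ m) (sym P≡2m+1) (ℕ.+-monoˡ-≤ m (ℕ.≰⇒> v≰m)))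

    by-size : Dec (v ≤ m) → BalancedRep r
    by-size (yes v≤m) = record
      { dir = up ; size = v ; inRange = v≥1 , v≤m
      ; rep = ≈-trans (≈-residue r) (≈-reflexive (sym (ℤ.*-identityˡ (+ v)))) }
    by-size (no v≰m) = record
      { dir = down ; size = P ∸ v ; inRange = ℕ.m<n⇒0<n∸m v<P , P∸v≤m v≰m
      ; rep = begin
          r                  ≈⟨ ≈-residue r ⟩
          + v                ≈⟨ minus-modulus (+ v) ⟨
          + v - + P          ≡⟨ ℤ.m-n≡m⊖n v P ⟩
          v ⊖ P              ≡⟨ ℤ.⊖-≤ (ℕ.<⇒≤ v<P) ⟩
          - + (P ∸ v)        ≡⟨ ℤ.-1*i≡-i (+ (P ∸ v)) ⟨
          -1ℤ ℤ.* + (P ∸ v)  ∎ }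
      where open ≈-Reasoning

  private
    inRange<P : ∀ {a} → InRange a → a < P
    inRange<P (_ , a≤m) = ℕ.≤-<-trans a≤m m<P

  step-nonzero : ∀ d {a} → InRange a → ¬ sgn d ℤ.* + a ≈ 0ℤ
  step-nonzero d {a} ra p = ℕ.<⇒≢ (proj₁ ra) (sym a≡0)
    where
    a≡0 : a ≡ 0
    a≡0 = signed-small d (inRange<P ra) (ℕ.≤-<-trans z≤n m<P)
            (≈-trans p (≈-reflexive (sym (ℤ.*-zeroʳ (sgn d)))))

  -- Opposite steps of sizes in [1, m] reach different classes, as 2 ≤ a + a' < P.
  no-opposite : ∀ {a a'} → InRange a → InRange a' → ¬ sgn up ℤ.* + a ≈ sgn down ℤ.* + a'
  no-opposite {a} {a'} (1≤a , a≤m) (_ , a'≤m) p =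
    ℕ.<⇒≢ (ℕ.≤-trans 1≤a (ℕ.m≤m+n a a')) (sym sum≡0)
    where
    sum≡0 : a ℕ.+ a' ≡ 0
    sum≡0 = ≈-small (sum<P a≤m a'≤m) (ℕ.≤-<-trans z≤n m<P) (begin
      + (a ℕ.+ a')                ≡⟨ cong (_+ + a') (ℤ.*-identityˡ (+ a)) ⟨
      sgn up ℤ.* + a + + a'       ≈⟨ +-cong p ≈-refl ⟩
      sgn down ℤ.* + a' + + a'    ≡⟨ cancel a' ⟩
      + 0                         ∎)
      where
      open ≈-Reasoning
      cancel : ∀ a → -1ℤ ℤ.* + a + + a ≡ 0ℤ
      cancel a = trans (cong (_+ + a) (ℤ.-1*i≡-i (+ a))) (ℤ.+-inverseˡ (+ a))

  balanced-unique : ∀ {d d' a a'} → InRange a → InRange a' →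
                    sgn d ℤ.* + a ≈ sgn d' ℤ.* + a' → d ≡ d' × a ≡ a'
  balanced-unique {up}   {up}   ra ra' p = refl , signed-small up (inRange<P ra) (inRange<P ra') p
  balanced-unique {down} {down} ra ra' p = refl , signed-small down (inRange<P ra) (inRange<P ra') p
  balanced-unique {up}   {down} ra ra' p = ⊥-elim (no-opposite ra ra' p)
  balanced-unique {down} {up}   ra ra' p = ⊥-elim (no-opposite ra' ra (≈-sym p))

move : ∀ {K} → Pt K → Fin K → Dir → Pt K
move x k d = updateAt x k (λ a → sgn d + a)

move-Γ : ∀ {K} (x : Pt K) k d → Γ x (move x k d)
move-Γ x k up   = k , inj₁ refl
move-Γ x k down = k , inj₂ refl

Γ⇒move : ∀ {K} {x y : Pt K} → Γ x y → Σ (Fin K) λ k → Σ Dir λ d → y ≡ move x k d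
Γ⇒move (k , inj₁ e) = k , up , e
Γ⇒move (k , inj₂ e) = k , down , e

lin : ∀ {K} → (Fin K → ℤ) → Pt K → ℤ
lin c []      = 0ℤ
lin c (a ∷ x) = c Fin.zero ℤ.* a + lin (c ∘ Fin.suc) x

lin-move : ∀ {K} (c : Fin K → ℤ) x k d → lin c (move x k d) ≡ lin c x + sgn d ℤ.* c k
lin-move c (a ∷ x) Fin.zero d = expand (c Fin.zero) a (lin (c ∘ Fin.suc) x) (sgn d)
  where
  expand : ∀ c a l s → c ℤ.* (s + a) + l ≡ (c ℤ.* a + l) + s ℤ.* c
  expand = solve-∀
lin-move c (a ∷ x) (Fin.suc k) d = begin
  c Fin.zero ℤ.* a + lin (c ∘ Fin.suc) (move x k d)
    ≡⟨ cong (λ s → c Fin.zero ℤ.* a + s) (lin-move (c ∘ Fin.suc) x k d) ⟩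
  c Fin.zero ℤ.* a + (lin (c ∘ Fin.suc) x + sgn d ℤ.* c (Fin.suc k))
    ≡⟨ ℤ.+-assoc (c Fin.zero ℤ.* a) _ _ ⟨
  c Fin.zero ℤ.* a + lin (c ∘ Fin.suc) x + sgn d ℤ.* c (Fin.suc k)  ∎
  where open ≡-Reasoning

lin-origin : ∀ K (c : Fin K → ℤ) → lin c (replicate K 0ℤ) ≡ 0ℤ
lin-origin zero    c = refl
lin-origin (suc K) c = cong₂ _+_ (ℤ.*-zeroʳ (c Fin.zero)) (lin-origin K (c ∘ Fin.suc))

Enumerable : Set → Set
Enumerable A = Σ (ℕ → A) λ e → ∀ a → Σ ℕ λ k → e k ≡ a

enum-map : ∀ {A B : Set} (f : A → B) → (∀ b → Σ A λ a → f a ≡ b) →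
           Enumerable A → Enumerable B
enum-map f f-onto (e , e-onto) = f ∘ e , λ b →
  let (a , fa≡b) = f-onto b ; (k , ek≡a) = e-onto a in k , trans (cong f ek≡a) fa≡b

enum-ℕ : Enumerable ℕ
enum-ℕ = (λ k → k) , λ a → a , refl

-- The diagonal walk through ℕ × ℕ: down each antidiagonal, then on to the next.
next : ℕ × ℕ → ℕ × ℕ
next (a , zero)  = zero , suc a
next (a , suc b) = suc a , b

diagonal : ℕ → ℕ × ℕ
diagonal zero    = 0 , 0
diagonal (suc k) = next (diagonal k)

diagonal-walk : ∀ t k {u v} → diagonal k ≡ (u , t ℕ.+ v) → diagonal (t ℕ.+ k) ≡ (u ℕ.+ t , v)
diagonal-walk zero    k {u} e = trans e (cong (_, _) (sym (ℕ.+-identityʳ u)))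
diagonal-walk (suc t) k {u} {v} e =
  trans (cong next (diagonal-walk t k (trans e (cong (u ,_) (sym (ℕ.+-suc t v))))))
        (cong (_, v) (sym (ℕ.+-suc u t)))

-- Every antidiagonal is entered: (0 , s + 1) follows the end (s , 0) of the previous one.
diagonal-start : ∀ s → Σ ℕ λ k → diagonal k ≡ (0 , s)
diagonal-start zero    = 0 , refl
diagonal-start (suc s) =
  let (k , e) = diagonal-start s
  in suc (s ℕ.+ k) , cong next (diagonal-walk s k (trans e (cong (0 ,_) (sym (ℕ.+-identityʳ s)))))

enum-ℕ×ℕ : Enumerable (ℕ × ℕ)
enum-ℕ×ℕ = diagonal , λ (a , b) →
  let (k , e) = diagonal-start (a ℕ.+ b) in a ℕ.+ k , diagonal-walk a k e

enum-× : ∀ {A B : Set} → Enumerable A → Enumerable B → Enumerable (A × B)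
enum-× (e , e-onto) (e' , e'-onto) =
  enum-map (λ (k , l) → e k , e' l)
           (λ (a , b) → let (k , p) = e-onto a ; (l , q) = e'-onto b in (k , l) , cong₂ _,_ p q)
           enum-ℕ×ℕ

enum-ℤ : Enumerable ℤ
enum-ℤ = enum-map (λ (a , b) → + a - + b) onto enum-ℕ×ℕ
  where
  onto : ∀ z → Σ (ℕ × ℕ) λ (a , b) → + a - + b ≡ z
  onto (+ a)    = (a , 0) , ℤ.+-identityʳ (+ a)
  onto -[1+ b ] = (0 , suc b) , ℤ.+-identityˡ -[1+ b ]

enum-Vec : ∀ {A : Set} K → Enumerable A → Enumerable (Vec A K)
enum-Vec zero    e = (λ _ → []) , λ { [] → 0 , refl }
enum-Vec (suc K) e =
  enum-map (λ (a , x) → a ∷ x) (λ { (a ∷ x) → (a , x) , refl }) (enum-× e (enum-Vec K e))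

-- Functions A → B are coded injectively by bit sequences when A × ℕ is enumerable
-- and B embeds in ℕ: bit k records whether f sends the k-th point to the k-th code.
module Coding {A B : Set} (enum : Enumerable (A × ℕ))
              (code : B → ℕ) (code-injective : ∀ {b b'} → code b ≡ code b' → b ≡ b') where

  encode : (A → B) → ℕ → Bool
  encode f k = let (a , c) = proj₁ enum k in does (code (f a) ℕ.≟ c)

  encode-injective : ∀ f g → (∀ k → encode f k ≡ encode g k) → ∀ a → f a ≡ g a
  encode-injective f g same a = sym (code-injective g-hits)
    where
    k : ℕ
    k = proj₁ (proj₂ enum (a , code (f a)))

    kth : proj₁ enum k ≡ (a , code (f a))
    kth = proj₂ (proj₂ enum (a , code (f a)))

    f-hits : encode f k ≡ true
    f-hits = trans (cong (λ (a' , c) → does (code (f a') ℕ.≟ c)) kth)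
                   (dec-true (code (f a) ℕ.≟ code (f a)) refl)

    holds : ∀ {P : Set} (p? : Dec P) → does p? ≡ true → P
    holds (yes p) _ = p

    g-hits : code (g a) ≡ code (f a)
    g-hits = holds (code (g a) ℕ.≟ code (f a))
      (trans (sym (cong (λ (a' , c) → does (code (g a') ℕ.≟ c)) kth)) (trans (sym (same k)) f-hits))

bit : Bool → ℕ
bit true  = 1
bit false = 0

bit-injective : ∀ {b c} → bit b ≡ bit c → b ≡ c
bit-injective {true}  {true}  _ = refl
bit-injective {false} {false} _ = refl
bit-injective {true}  {false} ()
bit-injective {false} {true}  ()

module Construction (m n : ℕ) .{{_ : NonZero m}} .{{_ : NonZero n}} where

  M Q N : ℕ
  M = 2 * m * n
  Q = 2 * n
  N = (M ℕ.+ n) / n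

  instance
    Q≢0 : NonZero Q
    Q≢0 = ℕ.m*n≢0 2 n

  N≡2m+1 : N ≡ suc (m ℕ.+ m)
  N≡2m+1 = trans (/-congˡ (factor m n)) (m*n/n≡m (suc (m ℕ.+ m)) n)
    where
    factor : ∀ m n → 2 * m * n ℕ.+ n ≡ suc (m ℕ.+ m) * n
    factor = ℕ-Solver.solve-∀

  instance
    N≢0 : NonZero N
    N≢0 = subst NonZero (sym N≡2m+1) _

  module Mod-N = Residues N
  module Mod-Q = Residues Q
  open Balanced m N N≡2m+1

  -- The M = m · 2n axes are indexed by pairs in Fin m × Fin Q; axis k has
  -- weight in [1, m] and phase in [0, Q).
  -- (Opaque, so that the transport along the arithmetic identity is never unfolded.)
  opaque
    axes : Fin M ↔ (Fin m × Fin Q)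
    axes = subst (λ K → Fin K ↔ (Fin m × Fin Q)) (regroup m n) *↔×
      where
      regroup : ∀ m n → m * (2 * n) ≡ 2 * m * n
      regroup = ℕ-Solver.solve-∀

  open Inverse axes using (to; from; strictlyInverseˡ; strictlyInverseʳ)

  weight phase : Fin M → ℕ
  weight k = suc (toℕ (proj₁ (to k)))
  phase  k = toℕ (proj₂ (to k))

  weight-inRange : ∀ k → InRange (weight k)
  weight-inRange k = s≤s z≤n , toℕ<n (proj₁ (to k))

  phase<Q : ∀ k → phase k < Q
  phase<Q k = toℕ<n (proj₂ (to k))

  axis-of : ∀ {a b} → InRange a → b < Q → Σ (Fin M) λ k → weight k ≡ a × phase k ≡ b
  axis-of {suc a} {b} (_ , a<m) b<Q =
    from pair , trans (cong (suc ∘ toℕ ∘ proj₁) to-from) (cong suc (toℕ-fromℕ< a<m))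
              , trans (cong (toℕ ∘ proj₂) to-from) (toℕ-fromℕ< b<Q)
    where
    pair : Fin m × Fin Q
    pair = fromℕ< a<m , fromℕ< b<Q

    to-from : to (from pair) ≡ pair
    to-from = strictlyInverseˡ pair

  axis-injective : ∀ {k k'} → weight k ≡ weight k' → phase k ≡ phase k' → k ≡ k'
  axis-injective {k} {k'} same-weight same-phase = begin
    k             ≡⟨ strictlyInverseʳ k ⟨
    from (to k)   ≡⟨ cong from (cong₂ _,_ (toℕ-injective (ℕ.suc-injective same-weight))
                                           (toℕ-injective same-phase)) ⟩
    from (to k')  ≡⟨ strictlyInverseʳ k' ⟩
    k'            ∎
    where open ≡-Reasoning

  R W T : Pt M → ℤ
  R = lin (λ k → + weight k)
  W = lin (λ k → + phase k)
  T = lin (λ _ → 1ℤ)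

  T-move : ∀ x k d → T (move x k d) ≡ T x + sgn d
  T-move x k d = trans (lin-move (λ _ → 1ℤ) x k d) (cong (λ s → T x + s) (ℤ.*-identityʳ (sgn d)))

  twist : (ℕ → Bool) → ℤ → ℤ
  twist α (+ t)    = + bit (α t)
  twist α -[1+ _ ] = 0ℤ

  colour : (ℕ → Bool) → Pt M → ℤ
  colour α x = W x + twist α (T x)

  -- Along a move in direction d the twist is the same for every axis, so the
  -- colour is a fixed base value plus ±phase.
  colour-move : ∀ α x k d →
    colour α (move x k d) ≡ (W x + twist α (T x + sgn d)) + sgn d ℤ.* + phase k
  colour-move α x k d = begin
    W (move x k d) + twist α (T (move x k d))
      ≡⟨ cong₂ (λ w t → w + twist α t) (lin-move (λ k → + phase k) x k d) (T-move x k d) ⟩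
    (W x + sgn d ℤ.* + phase k) + twist α (T x + sgn d)
      ≡⟨ swap (W x) _ _ ⟩
    (W x + twist α (T x + sgn d)) + sgn d ℤ.* + phase k  ∎
    where
    open ≡-Reasoning
    swap : ∀ a b c → (a + b) + c ≡ (a + c) + b
    swap = solve-∀

  label : (ℕ → Bool) → Family M n
  label α x = Mod-N.cls (R x) , Mod-Q.cls (colour α x)

  -- X^i is independent: a move changes R by ±weight ≢ 0 (mod N).
  independent : ∀ α (i : Fin N) x → proj₁ (label α x) ≡ i →
                ∀ y → Γ x y → proj₁ (label α y) ≢ i
  independent α i x x∈ y γ y∈ with Γ⇒move γ
  ... | k , d , refl = step-nonzero d (weight-inRange k) (Mod-N.+-cancelˡ (R x) (begin
    R x + sgn d ℤ.* + weight k  ≡⟨ lin-move (λ k → + weight k) x k d ⟨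
    R (move x k d)              ≈⟨ Mod-N.cls≡⇒≈ y∈ ⟩
    + toℕ i                     ≈⟨ Mod-N.cls≡⇒≈ x∈ ⟨
    R x                         ≡⟨ ℤ.+-identityʳ (R x) ⟨
    R x + 0ℤ                    ∎))
    where open Mod-N.≈-Reasoning

  -- The neighbours of x in X^i_j, given the balanced representative ±size of the
  -- gap between i and the class of R x: the gap fixes the direction and weight of
  -- the move, and then the colour fixes its phase.
  module Landing (α : ℕ → Bool) (i : Fin N) (j : Fin Q) (x : Pt M)
                 (target : BalancedRep (+ toℕ i - R x)) where

    open BalancedRep target public

    -- the colour reached by moving in direction dir along a phase-0 axis
    base : ℤ
    base = W x + twist α (T x + sgn dir)

    shift : Σ ℕ λ b → b < Q × sgn dir ℤ.* + b Mod-Q.≈ + toℕ j - base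
    shift = Mod-Q.signed-residue dir (+ toℕ j - base)

    b : ℕ
    b = proj₁ shift

    b<Q : b < Q
    b<Q = proj₁ (proj₂ shift)

    b-rep : sgn dir ℤ.* + b Mod-Q.≈ + toℕ j - base
    b-rep = proj₂ (proj₂ shift)

    axis : Σ (Fin M) λ k → weight k ≡ size × phase k ≡ b
    axis = axis-of inRange b<Q

    k : Fin M
    k = proj₁ axis

    k-weight : weight k ≡ size
    k-weight = proj₁ (proj₂ axis)

    k-phase : phase k ≡ b
    k-phase = proj₂ (proj₂ axis)

    reaches : label α (move x k dir) ≡ (i , j)
    reaches = cong₂ _,_ (Mod-N.≈⇒cls≡ R-hit) (Mod-Q.≈⇒cls≡ colour-hit)
      where
      R-hit : R (move x k dir) Mod-N.≈ + toℕ i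
      R-hit = begin
        R (move x k dir)              ≡⟨ lin-move (λ k → + weight k) x k dir ⟩
        R x + sgn dir ℤ.* + weight k  ≡⟨ cong (λ a → R x + sgn dir ℤ.* + a) k-weight ⟩
        R x + sgn dir ℤ.* + size      ≈⟨ Mod-N.transpose⁻ (R x) (Mod-N.≈-sym rep) ⟩
        + toℕ i                       ∎
        where open Mod-N.≈-Reasoning

      colour-hit : colour α (move x k dir) Mod-Q.≈ + toℕ j
      colour-hit = begin
        colour α (move x k dir)       ≡⟨ colour-move α x k dir ⟩
        base + sgn dir ℤ.* + phase k  ≡⟨ cong (λ c → base + sgn dir ℤ.* + c) k-phase ⟩
        base + sgn dir ℤ.* + b        ≈⟨ Mod-Q.transpose⁻ base b-rep ⟩
        + toℕ j                       ∎
        where open Mod-Q.≈-Reasoning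

    R-lands : ∀ k' d' → Mod-N.cls (R (move x k' d')) ≡ i →
              sgn d' ℤ.* + weight k' Mod-N.≈ sgn dir ℤ.* + size
    R-lands k' d' e = Mod-N.≈-trans (Mod-N.transpose (R x) (begin
      R x + sgn d' ℤ.* + weight k'  ≡⟨ lin-move (λ k → + weight k) x k' d' ⟨
      R (move x k' d')              ≈⟨ Mod-N.cls≡⇒≈ e ⟩
      + toℕ i                       ∎)) rep
      where open Mod-N.≈-Reasoning

    colour-lands : ∀ k' → Mod-Q.cls (colour α (move x k' dir)) ≡ j → phase k' ≡ b
    colour-lands k' e = Mod-Q.signed-small dir (phase<Q k') b<Q (Mod-Q.≈-trans (Mod-Q.transpose base (begin
      base + sgn dir ℤ.* + phase k'  ≡⟨ colour-move α x k' dir ⟨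
      colour α (move x k' dir)       ≈⟨ Mod-Q.cls≡⇒≈ e ⟩
      + toℕ j                        ∎)) (Mod-Q.≈-sym b-rep))
      where open Mod-Q.≈-Reasoning

    same-move : ∀ k' d' → label α (move x k' d') ≡ (i , j) → (k' , d') ≡ (k , dir)
    same-move k' d' e =
      cong₂ _,_ (axis-injective {k'} {k} (trans weight≡size (sym k-weight))
                                         (trans (colour-lands k' e-colour) (sym k-phase)))
                d'≡dir
      where
      same-step : d' ≡ dir × weight k' ≡ size
      same-step = balanced-unique {d'} {dir} {weight k'} {size} (weight-inRange k') inRange
                                  (R-lands k' d' (cong proj₁ e))

      d'≡dir : d' ≡ dir
      d'≡dir = proj₁ same-step

      weight≡size : weight k' ≡ size
      weight≡size = proj₂ same-step

      e-colour : Mod-Q.cls (colour α (move x k' dir)) ≡ j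
      e-colour = subst (λ d → Mod-Q.cls (colour α (move x k' d)) ≡ j) d'≡dir (cong proj₂ e)

    only : ∀ z → Γ x z → label α z ≡ (i , j) → z ≡ move x k dir
    only z γ z∈ with Γ⇒move γ
    ... | k' , d' , refl = cong (λ (k'' , d'') → move x k'' d'') (same-move k' d' z∈)

  unique-neighbour : ∀ α (i : Fin N) (j : Fin Q) x → proj₁ (label α x) ≢ i →
    Σ (Pt M) λ y → (Γ x y × label α y ≡ (i , j)) ×
                   (∀ z → Γ x z → label α z ≡ (i , j) → z ≡ y)
  unique-neighbour α i j x x∉ = move x k dir , (move-Γ x k dir , reaches) , only
    where
    gap≉0 : ¬ (+ toℕ i - R x) Mod-N.≈ 0ℤ
    gap≉0 p = x∉ (Mod-N.≈⇒cls≡ (Mod-N.≈-trans (Mod-N.≈-reflexive (sym (ℤ.+-identityʳ (R x))))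
                                             (Mod-N.transpose⁻ (R x) (Mod-N.≈-sym p))))

    open Landing α i j x (balanced-rep (+ toℕ i - R x) gap≉0)

  label-filling : ∀ α → IsFilling M n (label α)
  label-filling α i j x = unique-neighbour α i j x , independent α i x

  k₀ : Fin M
  k₀ = from (fromℕ< (ℕ.>-nonZero⁻¹ m) , fromℕ< (ℕ.>-nonZero⁻¹ Q))

  ray : ℕ → Pt M
  ray zero    = replicate M 0ℤ
  ray (suc t) = move (ray t) k₀ up

  T-ray : ∀ t → T (ray t) ≡ + t
  T-ray zero    = lin-origin M (λ _ → 1ℤ)
  T-ray (suc t) = trans (T-move (ray t) k₀ up) (trans (cong (_+ 1ℤ) (T-ray t)) (ℤ.+-comm (+ t) 1ℤ))

  -- The colour at ray t differs between α and β by α(t) - β(t), so the families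
  -- determine α.
  label-injective : ∀ α β → (∀ x → label α x ≡ label β x) → ∀ t → α t ≡ β t
  label-injective α β same t = bit-injective (Mod-Q.≈-small (bit<Q (α t)) (bit<Q (β t))
    (Mod-Q.+-cancelˡ (W (ray t)) (begin
      W (ray t) + + bit (α t)  ≡⟨ cong (λ s → W (ray t) + twist α s) (T-ray t) ⟨
      colour α (ray t)         ≈⟨ Mod-Q.cls-injective (cong proj₂ (same (ray t))) ⟩
      colour β (ray t)         ≡⟨ cong (λ s → W (ray t) + twist β s) (T-ray t) ⟩
      W (ray t) + + bit (β t)  ∎)))
    where
    open Mod-Q.≈-Reasoning
    bit<Q : ∀ b → bit b < Q
    bit<Q true  = ℕ.*-monoʳ-≤ 2 (ℕ.>-nonZero⁻¹ n)
    bit<Q false = ℕ.>-nonZero⁻¹ Q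

  label-code : Fin N × Fin Q → ℕ
  label-code (i , j) = toℕ (combine i j)

  label-code-injective : ∀ {l l'} → label-code l ≡ label-code l' → l ≡ l'
  label-code-injective {i , j} {i' , j'} e = begin
    (i , j)                        ≡⟨ remQuot-combine i j ⟨
    remQuot Q (combine i j)        ≡⟨ cong (remQuot Q) (toℕ-injective e) ⟩
    remQuot Q (combine i' j')      ≡⟨ remQuot-combine i' j' ⟩
    (i' , j')                      ∎
    where open ≡-Reasoning

  open Coding (enum-× (enum-Vec M enum-ℤ) enum-ℕ) label-code label-code-injective public

lemma4p4 : (m n : ℕ) → .{{_ : NonZero m}} → .{{_ : NonZero n}} →
    ContinuumManyFilling (2 * m * n) n
lemma4p4 m n = (label , label-filling , label-injective)
             , (encode , λ X Y _ _ → encode-injective X Y)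
  where open Construction m n
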